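{- For a family $\mathcal T$ of subsets of $\mathcal L$, the following are equivalent: (i) $\mathcal T=\mathrm{ext}(D,W)$ for some default theory $(D,W)$ with $D$ finite; (ii) $\mathcal T$ is a finite non-including family of theories, each of which is finitely generated over the intersection $U=\bigcap\mathcal T$, i.e., each $T\in\mathcal T$ is of the form $Cn(U\cup F)$ for some finite $F\subseteq\mathcal L$.
   Context: $\mathcal L$ is the set of formulas of a propositional language over a denumerable set of atoms; $Cn$ denotes propositional consequence, and a theory is a subset of $\mathcal L$ closed under $Cn$. A family $\mathcal T$ of subsets of $\mathcal L$ is non-including if each member is a theory and for all $T,T'\in\mathcal T$, $T\subseteq T'$ implies $T=T'$. A default is an expression $d=\frac{\alpha:\Gamma}{\beta}$ with $\alpha,\beta\in\mathcal L$ and $\Gamma$ a finite subset of $\mathcal L$; write $p(d)=\alpha$, $j(d)=\Gamma$, $c(d)=\beta$. A default theory is a pair $(D,W)$ with $D$ a set of defaults and $W\subseteq\mathcal L$. For a theory $S$, $d$ is $S$-applicable if $S\not\vdash\neg\gamma$ for every $\gamma\in j(d)$. The reduct $D_S$ is the set of monotone rules $\frac{p(d)}{c(d)}$ for $S$-applicable $d\in D$, and $Cn^{D_S}(W)$ is the set of formulas provable from $W$ in propositional calculus extended by the rules in $D_S$. A theory $S$ is an extension of $(D,W)$ iff $S=Cn^{D_S}(W)$; $\mathrm{ext}(D,W)$ denotes the family of all extensions. -}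

module Defs where

open import Level using (Level; 0ℓ; _⊔_) renaming (suc to lsuc)
open import Data.Nat using (ℕ)
open import Data.List using (List; [])
open import Data.List.Relation.Unary.All using (All)
open import Data.List.Relation.Unary.Any using (Any)
open import Data.List.Membership.Propositional using () renaming (_∈_ to _∈ˡ_)
open import Data.Product using (Σ; ∃; ∃-syntax; _×_; _,_)
open import Relation.Binary.PropositionalEquality using (_≡_)
open import Relation.Nullary using (¬_)
open import Data.Empty using (⊥)
open import Relation.Unary using (Pred; _⊆_; _≐_; _∪_)

infixr 6 _⇒_
infixr 7 _∨_
infixr 8 _∧_

data Form : Set where
  atom : ℕ → Form
  ⊥'   : Form
  _⇒_  : Form → Form → Form
  _∧_  : Form → Form → Form
  _∨_  : Form → Form → Form

∼_ : Form → Form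
∼ φ = φ ⇒ ⊥'

data Axiom : Form → Set where
  axK : ∀ φ ψ → Axiom (φ ⇒ ψ ⇒ φ)
  axS : ∀ φ ψ χ → Axiom ((φ ⇒ ψ ⇒ χ) ⇒ (φ ⇒ ψ) ⇒ φ ⇒ χ)
  DNE : ∀ φ → Axiom (∼ ∼ φ ⇒ φ)
  ∧E₁ : ∀ φ ψ → Axiom (φ ∧ ψ ⇒ φ)
  ∧E₂ : ∀ φ ψ → Axiom (φ ∧ ψ ⇒ ψ)
  ∧I  : ∀ φ ψ → Axiom (φ ⇒ ψ ⇒ φ ∧ ψ)
  ∨I₁ : ∀ φ ψ → Axiom (φ ⇒ φ ∨ ψ)
  ∨I₂ : ∀ φ ψ → Axiom (ψ ⇒ φ ∨ ψ)
  ∨E  : ∀ φ ψ χ → Axiom ((φ ⇒ χ) ⇒ (ψ ⇒ χ) ⇒ φ ∨ ψ ⇒ χ)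

-- Monotone rules α / β, given as a set of pairs (α , β)
Rules : Set₁
Rules = Pred (Form × Form) 0ℓ

data Der {ℓ : Level} (R : Rules) (X : Pred Form ℓ) : Form → Set ℓ where
  ax   : ∀ {φ} → Axiom φ → Der R X φ
  hyp  : ∀ {φ} → X φ → Der R X φ
  mp   : ∀ {φ ψ} → Der R X (φ ⇒ ψ) → Der R X φ → Der R X ψ
  rule : ∀ {α β} → R (α , β) → Der R X α → Der R X β

noRules : Rules
noRules _ = ⊥

CnR : ∀ {ℓ} → Rules → Pred Form ℓ → Pred Form ℓ
CnR R X = Der R X

Cn : ∀ {ℓ} → Pred Form ℓ → Pred Form ℓ
Cn X = Der noRules X

⟦_⟧ˡ : List Form → Pred Form 0ℓ
⟦ F ⟧ˡ φ = φ ∈ˡ F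

IsTheory : ∀ {ℓ} → Pred Form ℓ → Set ℓ
IsTheory T = Cn T ⊆ T

record Default : Set where
  constructor _∶_/_
  field
    p : Form
    j : List Form
    c : Form
open Default public

Applicable : Pred Form 0ℓ → Default → Set
Applicable S d = ∀ γ → γ ∈ˡ j d → ¬ Cn S (∼ γ)

Reduct : Pred Default 0ℓ → Pred Form 0ℓ → Rules
Reduct D S (α , β) = ∃[ d ] (D d × Applicable S d × p d ≡ α × c d ≡ β)

IsExtension : Pred Default 0ℓ → Pred Form 0ℓ → Pred Form 0ℓ → Set
IsExtension D W S = IsTheory S × (S ≐ CnR (Reduct D S) W)

-- Families of subsets of L (subsets are predicates, equal when ≐)

Family : Set₁
Family = Pred (Pred Form 0ℓ) 0ℓ

ext : Pred Default 0ℓ → Pred Form 0ℓ → Family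
ext D W S = IsExtension D W S

_≋_ : Family → Family → Set₁
𝒯 ≋ 𝒮 = (∀ T → 𝒯 T → ∃[ S ] (𝒮 S × T ≐ S))
      × (∀ S → 𝒮 S → ∃[ T ] (𝒯 T × T ≐ S))

FiniteFamily : Family → Set₁
FiniteFamily 𝒯 = ∃[ Ts ] (All 𝒯 Ts × (∀ T → 𝒯 T → Any (T ≐_) Ts))

NonIncluding : Family → Set₁
NonIncluding 𝒯 = (∀ T → 𝒯 T → IsTheory T)
               × (∀ T T′ → 𝒯 T → 𝒯 T′ → T ⊆ T′ → T ≐ T′)

⋂𝒯 : Family → Pred Form (lsuc 0ℓ)
⋂𝒯 𝒯 φ = ∀ T → 𝒯 T → T φ

FinGenOverIntersection : Family → Set₁
FinGenOverIntersection 𝒯 =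
  ∀ T → 𝒯 T → ∃[ F ] (T ≐ Cn (⋂𝒯 𝒯 ∪ ⟦ F ⟧ˡ))

⟦_⟧ᴰ : List Default → Pred Default 0ℓ
⟦ D ⟧ᴰ d = d ∈ˡ D

{-# OPTIONS --safe #-}
-- (i) ⇒ (ii): an extension S equals Cn (W ∪ c(GD)) for its set GD ⊆ D of generating
-- defaults, so there are at most 2^|D| extensions; S ⊆ S′ shrinks the reduct of S′ below
-- that of S, so extensions are incomparable; and W lies in every extension, so each is
-- finitely generated over their intersection.
-- (ii) ⇒ (i): with W = ⋂𝒯 and each member U = Cn (W ∪ F_U), take the defaults ⊤ : J(U) / f
-- for f ∈ F_U, where J(U) contains ¬ψ for one ψ ∈ V ∖ U per member V ⊈ U. A theory S is
-- compatible with J(U) iff every member V ⊆ S is contained in U; so the members are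
-- extensions and each extension is the member whose justifications it admits. The empty
-- family is the family of extensions of ⊤ : a / ¬a.
module Submission where

open import Defs
open import Level using (Level; 0ℓ; lift; lower) renaming (suc to lsuc)
open import Function using (id; _∘_)
open import Data.Bool using (Bool; true; false; not) renaming (_∧_ to _&&_; _∨_ to _||_)
open import Data.Unit using (⊤; tt)
open import Data.Empty using (⊥; ⊥-elim)
open import Data.Product using (Σ; ∃-syntax; _×_; _,_; proj₁; proj₂)
open import Data.Sum using (_⊎_; inj₁; inj₂)
import Data.Sum as Sum
open import Data.List using (List; []; _∷_; map; _++_; filter; concat)
open import Data.List.Relation.Unary.All as All using (All; []; _∷_)
open import Data.List.Relation.Unary.Any using (Any; here; there; any?)
open import Data.List.Membership.Propositional using (_∈_; mapWith∈; find; lose)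
open import Data.List.Membership.Propositional.Properties
  using (∈-++⁺ˡ; ∈-++⁺ʳ; ∈-map⁺; ∈-map⁻; ∈-filter⁺; ∈-map∘filter⁻; ∈-concat⁺; ∈-concat⁻)
open import Data.List.Relation.Unary.Any.Properties using (mapWith∈⁺; mapWith∈⁻)
open import Relation.Nullary using (¬_; yes; no; does)
open import Relation.Nullary.Decidable using (map′; decidable-stable)
open import Relation.Binary.PropositionalEquality using (_≡_; refl)
open import Relation.Unary using (Pred; Decidable; _⊆_; _≐_; _∪_; ∅)
open import Relation.Unary.Properties using (≐-sym; ≐-trans)
open import Axiom.ExcludedMiddle using (ExcludedMiddle)

private variable
  ℓ ℓ₁ ℓ₂ ℓ₃ : Level
  R R′ : Rules
  X : Pred Form ℓ₁
  Y : Pred Form ℓ₂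
  Z : Pred Form ℓ₃
  S S′ T : Pred Form 0ℓ
  φ ψ : Form

⊤' : Form
⊤' = ∼ ⊥'

ClosedUnder : Rules → Pred Form ℓ → Set ℓ
ClosedUnder R T = ∀ {α β} → R (α , β) → T α → T β

Der-mono : R ⊆ R′ → X ⊆ Y → Der R X ⊆ Der R′ Y
Der-mono R⊆ X⊆ (ax a)     = ax a
Der-mono R⊆ X⊆ (hyp x)    = hyp (X⊆ x)
Der-mono R⊆ X⊆ (mp d e)   = mp (Der-mono R⊆ X⊆ d) (Der-mono R⊆ X⊆ e)
Der-mono R⊆ X⊆ (rule r d) = rule (R⊆ r) (Der-mono R⊆ X⊆ d)

Cn-mono : X ⊆ Y → Cn X ⊆ Cn Y
Cn-mono = Der-mono id

Der-least : {T : Pred Form ℓ} → IsTheory T → ClosedUnder R T → X ⊆ T → Der R X ⊆ T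
Der-least th cl X⊆T (ax a)     = th (ax a)
Der-least th cl X⊆T (hyp x)    = X⊆T x
Der-least th cl X⊆T (mp d e)   = th (mp (hyp (Der-least th cl X⊆T d)) (hyp (Der-least th cl X⊆T e)))
Der-least th cl X⊆T (rule r d) = cl r (Der-least th cl X⊆T d)

Cn-least : {T : Pred Form ℓ} → IsTheory T → X ⊆ T → Cn X ⊆ T
Cn-least th = Der-least th (λ ())

Der-isTheory : IsTheory (Der R X)
Der-isTheory (ax a)   = ax a
Der-isTheory (hyp d)  = d
Der-isTheory (mp d e) = mp (Der-isTheory d) (Der-isTheory e)

IsTheory-resp-≐ : T ≐ S → IsTheory S → IsTheory T
IsTheory-resp-≐ (T⊆S , S⊆T) th = S⊆T ∘ th ∘ Cn-mono T⊆S

⇒-refl : ∀ φ → Der R X (φ ⇒ φ)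
⇒-refl φ = mp (mp (ax (axS φ (φ ⇒ φ) φ)) (ax (axK φ (φ ⇒ φ)))) (ax (axK φ φ))

⊤'-derivable : Der R X ⊤'
⊤'-derivable = ⇒-refl ⊥'

¬¬-intro : Der R X ψ → Der R X (∼ ∼ ψ)
¬¬-intro {ψ = ψ} d = mp (mp (ax (axS (∼ ψ) ψ ⊥')) (⇒-refl (∼ ψ))) (mp (ax (axK ψ (∼ ψ))) d)

¬¬-elim : Der R X (∼ ∼ ψ) → Der R X ψ
¬¬-elim {ψ = ψ} = mp (ax (DNE ψ))

Cn-∪-widen : IsTheory T → X ⊆ Y → Y ⊆ T → T ≐ Cn (X ∪ Z) → T ≐ Cn (Y ∪ Z)
Cn-∪-widen th X⊆Y Y⊆T (T⊆ , ⊆T) =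
  Cn-mono (Sum.map₁ X⊆Y) ∘ T⊆ ,
  Cn-least th λ { (inj₁ y) → Y⊆T y ; (inj₂ z) → ⊆T (hyp (inj₂ z)) }

-- Soundness for the valuation making every atom true.

eval : Form → Bool
eval (atom _) = true
eval ⊥'       = false
eval (φ ⇒ ψ)  = not (eval φ) || eval ψ
eval (φ ∧ ψ)  = eval φ && eval ψ
eval (φ ∨ ψ)  = eval φ || eval ψ

axiom-true : Axiom φ → eval φ ≡ true
axiom-true (axK φ ψ) with eval φ | eval ψ
... | false | _     = refl
... | true  | false = refl
... | true  | true  = refl
axiom-true (axS φ ψ χ) with eval φ | eval ψ | eval χ
... | false | _     | _     = refl
... | true  | false | _     = refl
... | true  | true  | false = refl
... | true  | true  | true  = refl
axiom-true (DNE φ) with eval φ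
... | false = refl
... | true  = refl
axiom-true (∧E₁ φ ψ) with eval φ | eval ψ
... | false | _     = refl
... | true  | false = refl
... | true  | true  = refl
axiom-true (∧E₂ φ ψ) with eval φ | eval ψ
... | false | _     = refl
... | true  | false = refl
... | true  | true  = refl
axiom-true (∧I φ ψ) with eval φ | eval ψ
... | false | _     = refl
... | true  | false = refl
... | true  | true  = refl
axiom-true (∨I₁ φ ψ) with eval φ
... | false = refl
... | true  = refl
axiom-true (∨I₂ φ ψ) with eval φ | eval ψ
... | _     | false = refl
... | false | true  = refl
... | true  | true  = refl
axiom-true (∨E φ ψ χ) with eval φ | eval ψ | eval χ
... | false | false | _     = refl
... | false | true  | false = refl
... | false | true  | true  = refl
... | true  | _     | false = refl
... | true  | false | true  = refl
... | true  | true  | true  = refl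

modus-ponens-true : ∀ a b → not a || b ≡ true → a ≡ true → b ≡ true
modus-ponens-true true _ a⇒b refl = a⇒b

Cn-∅-true : Cn ∅ φ → eval φ ≡ true
Cn-∅-true (ax a) = axiom-true a
Cn-∅-true (mp {φ} {ψ} d e) = modus-ponens-true (eval φ) (eval ψ) (Cn-∅-true d) (Cn-∅-true e)

∼atom-underivable : ∀ n → ¬ Cn ∅ (∼ atom n)
∼atom-underivable n d with Cn-∅-true d
... | ()

Compatible : Pred Form 0ℓ → List Form → Set
Compatible S Γ = ∀ γ → γ ∈ Γ → ¬ Cn S (∼ γ)

Compatible-antitone : ∀ {Γ} → S ⊆ S′ → Compatible S′ Γ → Compatible S Γ
Compatible-antitone S⊆S′ c γ γ∈ = c γ γ∈ ∘ Cn-mono S⊆S′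

Reduct-antitone : ∀ {D} → S ⊆ S′ → Reduct D S′ ⊆ Reduct D S
Reduct-antitone S⊆S′ (d , d∈ , app , pd , cd) = d , d∈ , Compatible-antitone S⊆S′ app , pd , cd

extension-minimal : ∀ {D W} → IsExtension D W S → IsExtension D W S′ → S ⊆ S′ → S′ ⊆ S
extension-minimal (_ , _ , ⊆S) (_ , S′⊆ , _) S⊆S′ =
  ⊆S ∘ Der-mono (Reduct-antitone S⊆S′) id ∘ S′⊆

selfDefeating : Default
selfDefeating = ⊤' ∶ (atom 0 ∷ []) / (∼ atom 0)

selfDefeating-no-extension : ¬ IsExtension ⟦ selfDefeating ∷ [] ⟧ᴰ ∅ S
selfDefeating-no-extension {S} (th , S⊆ , ⊆S) = ∼a∉S ∼a∈S
  where
  ∼a∉S : ¬ Cn S (∼ atom 0)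
  ∼a∉S ⊢∼a = ∼atom-underivable 0 (Der-mono blocked id (S⊆ (th ⊢∼a)))
    where
    blocked : Reduct ⟦ selfDefeating ∷ [] ⟧ᴰ S ⊆ noRules
    blocked (_ , here refl , app , _) = app (atom 0) (here refl) ⊢∼a

  ∼a∈S : Cn S (∼ atom 0)
  ∼a∈S = hyp (⊆S (rule (selfDefeating , here refl , (λ { _ (here refl) → ∼a∉S }) , refl , refl)
                        ⊤'-derivable))

lowerEM : ExcludedMiddle (lsuc 0ℓ) → ExcludedMiddle 0ℓ
lowerEM em = map′ lower lift em

module GeneratingDefaults (em : ExcludedMiddle 0ℓ) where

  Generating : Pred Form 0ℓ → Default → Set
  Generating S d = Applicable S d × S (p d)

  generating? : ∀ S → Decidable (Generating S)
  generating? S _ = em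

  generatingDefaults : Pred Form 0ℓ → List Default → List Default
  generatingDefaults S = filter (generating? S)

  extension≐Cn-generated : ∀ {D W} → IsExtension ⟦ D ⟧ᴰ W S →
    S ≐ Cn (W ∪ ⟦ map c (generatingDefaults S D) ⟧ˡ)
  extension≐Cn-generated {S} {D} {W} (th , S⊆ , ⊆S) = toCn ∘ S⊆ , Cn-least th fromCn
    where
    toCn : Der (Reduct ⟦ D ⟧ᴰ S) W ⊆ Cn (W ∪ ⟦ map c (generatingDefaults S D) ⟧ˡ)
    toCn (ax a)   = ax a
    toCn (hyp w)  = hyp (inj₁ w)
    toCn (mp d e) = mp (toCn d) (toCn e)
    toCn (rule (d , d∈ , app , refl , refl) e) =
      hyp (inj₂ (∈-map⁺ c (∈-filter⁺ (generating? S) d∈ (app , ⊆S e))))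

    fromCn : W ∪ ⟦ map c (generatingDefaults S D) ⟧ˡ ⊆ S
    fromCn (inj₁ w) = ⊆S (hyp w)
    fromCn (inj₂ β∈) with ∈-map∘filter⁻ c (generating? S) β∈
    ... | d , d∈ , refl , app , pS = ⊆S (rule (d , d∈ , app , refl , refl) (S⊆ pS))

sublists : ∀ {A : Set} → List A → List (List A)
sublists []       = [] ∷ []
sublists (x ∷ xs) = map (x ∷_) (sublists xs) ++ sublists xs

filter∈sublists : ∀ {A : Set} {P : Pred A 0ℓ} (P? : Decidable P) xs → filter P? xs ∈ sublists xs
filter∈sublists P? []       = here refl
filter∈sublists P? (x ∷ xs) with does (P? x)
... | true  = ∈-++⁺ˡ (∈-map⁺ (x ∷_) (filter∈sublists P? xs))
... | false = ∈-++⁺ʳ (map (x ∷_) (sublists xs)) (filter∈sublists P? xs)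

finite-cover : ExcludedMiddle (lsuc 0ℓ) → (𝒯 : Family) (Cs : List (Pred Form 0ℓ)) →
  (∀ T → 𝒯 T → Any (T ≐_) Cs) → FiniteFamily 𝒯
finite-cover em 𝒯 Cs covered =
  let Ts , all , any = select Cs in Ts , all , λ T t → any T t (covered T t)
  where
  select : ∀ Cs → ∃[ Ts ] (All 𝒯 Ts × (∀ T → 𝒯 T → Any (T ≐_) Cs → Any (T ≐_) Ts))
  select [] = [] , [] , λ _ _ ()
  select (C ∷ Cs) with select Cs | em {∃[ T ] (𝒯 T × T ≐ C)}
  ... | Ts , all , any | yes (T₀ , t₀ , T₀≐C) =
    T₀ ∷ Ts , t₀ ∷ all ,
    λ { T t (here T≐C) → here (≐-trans T≐C (≐-sym T₀≐C)) ; T t (there a) → there (any T t a) }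
  ... | Ts , all , any | no none =
    Ts , all , λ { T t (here T≐C) → ⊥-elim (none (T , t , T≐C)) ; T t (there a) → any T t a }

separate : ExcludedMiddle 0ℓ → (U : Pred Form 0ℓ) (Vs : List (Pred Form 0ℓ)) →
  ∃[ Ψ ] (All (λ ψ → ¬ U ψ) Ψ × All (λ V → V ⊆ U ⊎ Any V Ψ) Vs)
separate em U [] = [] , [] , []
separate em U (V ∷ Vs) with separate em U Vs | em {∃[ ψ ] (V ψ × ¬ U ψ)}
... | Ψ , outside , sep | yes (ψ , v , ¬u) =
  ψ ∷ Ψ , ¬u ∷ outside , inj₂ (here v) ∷ All.map (Sum.map₂ there) sep
... | Ψ , outside , sep | no none =
  Ψ , outside , inj₁ (λ {ψ} v → decidable-stable em (λ ¬u → none (ψ , v , ¬u))) ∷ sep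

module _ {𝒯 : Family} {D : List Default} {W : Pred Form 0ℓ} (𝒯≋ext : 𝒯 ≋ ext ⟦ D ⟧ᴰ W) where

  ≋ext⇒FiniteFamily : ExcludedMiddle (lsuc 0ℓ) → FiniteFamily 𝒯
  ≋ext⇒FiniteFamily em = finite-cover em 𝒯 (map candidate (sublists D)) covered
    where
    open GeneratingDefaults (lowerEM em)

    candidate : List Default → Pred Form 0ℓ
    candidate G = Cn (W ∪ ⟦ map c G ⟧ˡ)

    covered : ∀ T → 𝒯 T → Any (T ≐_) (map candidate (sublists D))
    covered T t =
      let S , eS , T≐S = proj₁ 𝒯≋ext T t
      in lose (∈-map⁺ candidate (filter∈sublists (generating? S) D))
              (≐-trans T≐S (extension≐Cn-generated eS))

  ≋ext⇒NonIncluding : NonIncluding 𝒯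
  ≋ext⇒NonIncluding = theory , minimal
    where
    theory : ∀ T → 𝒯 T → IsTheory T
    theory T t = let _ , (thS , _) , T≐S = proj₁ 𝒯≋ext T t in IsTheory-resp-≐ T≐S thS

    minimal : ∀ T T′ → 𝒯 T → 𝒯 T′ → T ⊆ T′ → T ≐ T′
    minimal T T′ t t′ T⊆T′ =
      let S , eS , (T⊆S , S⊆T) = proj₁ 𝒯≋ext T t
          S′ , eS′ , (T′⊆S′ , S′⊆T′) = proj₁ 𝒯≋ext T′ t′
      in T⊆T′ , S⊆T ∘ extension-minimal eS eS′ (T′⊆S′ ∘ T⊆T′ ∘ S⊆T) ∘ T′⊆S′

  ≋ext⇒FinGen : ExcludedMiddle 0ℓ → FinGenOverIntersection 𝒯
  ≋ext⇒FinGen em T t =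
    let S , eS , T≐S = proj₁ 𝒯≋ext T t
    in map c (generatingDefaults S D) ,
       Cn-∪-widen (IsTheory-resp-≐ T≐S (proj₁ eS)) W⊆⋂𝒯 (λ u → u T t)
                  (≐-trans T≐S (extension≐Cn-generated eS))
    where
    open GeneratingDefaults em

    W⊆⋂𝒯 : W ⊆ ⋂𝒯 𝒯
    W⊆⋂𝒯 w T t = let _ , (_ , _ , ⊆S) , (_ , S⊆T) = proj₁ 𝒯≋ext T t in S⊆T (⊆S (hyp w))

module Representation
  (em : ExcludedMiddle 0ℓ)
  (W : Pred Form 0ℓ)
  (Ts : List (Pred Form 0ℓ)) {T₀ : Pred Form 0ℓ} (T₀∈ : T₀ ∈ Ts)
  (theory : ∀ {U} → U ∈ Ts → IsTheory U)
  (incomparable : ∀ {U V} → U ∈ Ts → V ∈ Ts → U ⊆ V → V ⊆ U)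
  (generators : ∀ {U} → U ∈ Ts → List Form)
  (generated : ∀ {U} (U∈ : U ∈ Ts) → U ≐ Cn (W ∪ ⟦ generators U∈ ⟧ˡ))
  where

  J : Pred Form 0ℓ → List Form
  J U = map ∼_ (proj₁ (separate em U Ts))

  defaultFor : Pred Form 0ℓ → Form → Default
  defaultFor U f = ⊤' ∶ J U / f

  D : List Default
  D = concat (mapWith∈ Ts λ {U} U∈ → map (defaultFor U) (generators U∈))

  ∈D⁺ : ∀ {U f} (U∈ : U ∈ Ts) → f ∈ generators U∈ → defaultFor U f ∈ D
  ∈D⁺ U∈ f∈ = ∈-concat⁺ (mapWith∈⁺ _ (_ , U∈ , ∈-map⁺ _ f∈))

  ∈D⁻ : ∀ {d} → d ∈ D → ∃[ U ] Σ (U ∈ Ts) λ U∈ → ∃[ f ] (f ∈ generators U∈ × d ≡ defaultFor U f)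
  ∈D⁻ d∈ with mapWith∈⁻ Ts _ (∈-concat⁻ _ d∈)
  ... | U , U∈ , d∈′ with ∈-map⁻ (defaultFor U) d∈′
  ...   | f , f∈ , refl = U , U∈ , f , f∈ , refl

  W⊆ : ∀ {U} → U ∈ Ts → W ⊆ U
  W⊆ U∈ w = proj₂ (generated U∈) (hyp (inj₁ w))

  generators⊆ : ∀ {U f} (U∈ : U ∈ Ts) → f ∈ generators U∈ → U f
  generators⊆ U∈ f∈ = proj₂ (generated U∈) (hyp (inj₂ f∈))

  ⊆⇒Compatible : ∀ {S U} → IsTheory S → S ⊆ U → Compatible S (J U)
  ⊆⇒Compatible {U = U} th S⊆U γ γ∈ ⊢∼γ with ∈-map⁻ ∼_ γ∈
  ... | ψ , ψ∈ , refl = All.lookup (proj₁ (proj₂ (separate em U Ts))) ψ∈ (S⊆U (th (¬¬-elim ⊢∼γ)))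

  Compatible⇒⊆ : ∀ {S U V} → Compatible S (J U) → V ∈ Ts → V ⊆ S → V ⊆ U
  Compatible⇒⊆ {U = U} compat V∈ V⊆S with All.lookup (proj₂ (proj₂ (separate em U Ts))) V∈
  ... | inj₁ V⊆U = V⊆U
  ... | inj₂ hit with find hit
  ...   | ψ , ψ∈ , vψ = ⊥-elim (compat (∼ ψ) (∈-map⁺ ∼_ ψ∈) (¬¬-intro (hyp (V⊆S vψ))))

  member⊆Cnᴿ : ∀ {S U} (U∈ : U ∈ Ts) → Compatible S (J U) → U ⊆ Der (Reduct ⟦ D ⟧ᴰ S) W
  member⊆Cnᴿ {S} {U} U∈ compat u = Cn-least Der-isTheory derivable (proj₁ (generated U∈) u)
    where
    derivable : W ∪ ⟦ generators U∈ ⟧ˡ ⊆ Der (Reduct ⟦ D ⟧ᴰ S) W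
    derivable (inj₁ w)  = hyp w
    derivable (inj₂ f∈) = rule (defaultFor U _ , ∈D⁺ U∈ f∈ , compat , refl , refl) ⊤'-derivable

  Cnᴿ⊆member : ∀ {S U} → U ∈ Ts → (∀ {V} → V ∈ Ts → Compatible S (J V) → V ⊆ U) →
    Der (Reduct ⟦ D ⟧ᴰ S) W ⊆ U
  Cnᴿ⊆member {S} {U} U∈ bound = Der-least (theory U∈) closed (W⊆ U∈)
    where
    closed : ClosedUnder (Reduct ⟦ D ⟧ᴰ S) U
    closed (d , d∈ , app , refl , refl) _ with ∈D⁻ d∈
    ... | V , V∈ , f , f∈ , refl = bound V∈ app (generators⊆ V∈ f∈)

  member⇒extension : ∀ {U} → U ∈ Ts → IsExtension ⟦ D ⟧ᴰ W U
  member⇒extension U∈ =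
    theory U∈ ,
    member⊆Cnᴿ U∈ (⊆⇒Compatible (theory U∈) id) ,
    Cnᴿ⊆member U∈ (λ V∈ compat → incomparable U∈ V∈ (Compatible⇒⊆ compat U∈ id))

  -- Some J(U) is compatible with an extension S, for otherwise S ⊆ T₀ and J(T₀) is.
  extension⇒member : ∀ {S} → IsExtension ⟦ D ⟧ᴰ W S → ∃[ U ] (U ∈ Ts × S ≐ U)
  extension⇒member {S} (th , S⊆ , ⊆S) with any? (λ U → em {Compatible S (J U)}) Ts
  ... | yes someCompatible =
    let U , U∈ , compat = find someCompatible
        V⊆S : ∀ {V} → V ∈ Ts → Compatible S (J V) → V ⊆ S
        V⊆S V∈ compatV = ⊆S ∘ member⊆Cnᴿ V∈ compatV
    in U , U∈ ,
       Cnᴿ⊆member U∈ (λ V∈ compatV → Compatible⇒⊆ compat V∈ (V⊆S V∈ compatV)) ∘ S⊆ ,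
       V⊆S U∈ compat
  ... | no noneCompatible = ⊥-elim (noneCompatible (lose T₀∈ (⊆⇒Compatible th S⊆T₀)))
    where
    S⊆T₀ : S ⊆ T₀
    S⊆T₀ = Cnᴿ⊆member T₀∈ (λ V∈ compatV → ⊥-elim (noneCompatible (lose V∈ compatV))) ∘ S⊆

-- ⋂𝒯 lives one universe up, so the W of the representation intersects the listed members.
⋂ˡ : List (Pred Form 0ℓ) → Pred Form 0ℓ
⋂ˡ []       φ = ⊤
⋂ˡ (T ∷ Ts) φ = T φ × ⋂ˡ Ts φ

⋂ˡ-lookup : ∀ {Ts} → T ∈ Ts → ⋂ˡ Ts ⊆ T
⋂ˡ-lookup (here refl) = proj₁
⋂ˡ-lookup (there T∈)  = ⋂ˡ-lookup T∈ ∘ proj₂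

⋂𝒯⊆⋂ˡ : ∀ {𝒯 : Family} {Ts} → All 𝒯 Ts → ⋂𝒯 𝒯 ⊆ ⋂ˡ Ts
⋂𝒯⊆⋂ˡ []         u = tt
⋂𝒯⊆⋂ˡ (t ∷ all) u = u _ t , ⋂𝒯⊆⋂ˡ all u

representable : ExcludedMiddle (lsuc 0ℓ) → (𝒯 : Family) →
  FiniteFamily 𝒯 × NonIncluding 𝒯 × FinGenOverIntersection 𝒯 → ∃[ D ] ∃[ W ] (𝒯 ≋ ext ⟦ D ⟧ᴰ W)
representable em 𝒯 (([] , _ , covered) , _) =
  selfDefeating ∷ [] , ∅ ,
  (λ T t → case (covered T t)) , (λ S eS → ⊥-elim (selfDefeating-no-extension eS))
  where
  case : Any (T ≐_) [] → ∃[ S ] (ext ⟦ selfDefeating ∷ [] ⟧ᴰ ∅ S × T ≐ S)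
  case ()
representable em 𝒯 ((Ts@(_ ∷ _) , all , covered) , (theory , minimal) , finGen) =
  D , ⋂ˡ Ts ,
  (λ T t → let U , U∈ , T≐U = find (covered T t) in U , member⇒extension U∈ , T≐U) ,
  (λ S eS → let U , U∈ , S≐U = extension⇒member eS in U , All.lookup all U∈ , ≐-sym S≐U)
  where
  member : ∀ {U} → U ∈ Ts → 𝒯 U
  member = All.lookup all

  open Representation (lowerEM em) (⋂ˡ Ts) Ts (here refl)
    (λ U∈ → theory _ (member U∈))
    (λ U∈ V∈ U⊆V → proj₂ (minimal _ _ (member U∈) (member V∈) U⊆V))
    (λ U∈ → proj₁ (finGen _ (member U∈)))
    (λ U∈ → Cn-∪-widen (theory _ (member U∈)) (⋂𝒯⊆⋂ˡ all) (⋂ˡ-lookup U∈)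
                       (proj₂ (finGen _ (member U∈))))

mainTheorem2 : ExcludedMiddle (lsuc 0ℓ) → (𝒯 : Family) →
    ((∃[ D ] ∃[ W ] (𝒯 ≋ ext ⟦ D ⟧ᴰ W))
      → (FiniteFamily 𝒯 × NonIncluding 𝒯 × FinGenOverIntersection 𝒯))
    × ((FiniteFamily 𝒯 × NonIncluding 𝒯 × FinGenOverIntersection 𝒯)
      → ∃[ D ] ∃[ W ] (𝒯 ≋ ext ⟦ D ⟧ᴰ W))
mainTheorem2 em 𝒯 =
  (λ (_ , _ , 𝒯≋ext) →
    ≋ext⇒FiniteFamily 𝒯≋ext em , ≋ext⇒NonIncluding 𝒯≋ext , ≋ext⇒FinGen 𝒯≋ext (lowerEM em)) ,
  representable em 𝒯
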